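{- Let $d\ge1$ and $n$ be integers with $2d\mid n$, and let $G$ be a simple, loopless, $d$-regular, triangle-free graph on $n$ vertices. Then $$ c_4(G) \leq c_4\!\left(\tfrac{n}{2d}K_{d,d}\right), $$ with equality if and only if $G$ is (isomorphic to) $\tfrac{n}{2d}K_{d,d}$.
   Context: $c_4(G)$ denotes the number of (not necessarily induced) cycles on four vertices contained in $G$ (i.e. subgraphs isomorphic to $C_4$). $\tfrac{n}{2d}K_{d,d}$ denotes the disjoint union of $n/2d$ copies of the complete bipartite graph $K_{d,d}$. -}

module Defs where

open import Data.Nat using (ℕ; zero; suc; _+_; _*_; _/_; _%_; _<ᵇ_)
open import Data.Nat.Properties using (_≟_)
open import Data.Bool using (Bool; true; false; _∧_; _xor_; if_then_else_; not)
open import Data.Bool.Properties using (xor-comm; xor-same)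
open import Data.Fin using (Fin; toℕ)
import Data.Fin.Properties as FinP
open import Data.List using (List; map; allFin)
open import Data.Nat.ListAction using (sum)
open import Relation.Nullary.Decidable using (⌊_⌋; yes; no)
open import Relation.Binary.PropositionalEquality using (_≡_; refl; sym)
open import Data.Product using (_×_; Σ)
open import Function.Bundles using (_↔_; Inverse)
open import Data.Empty using (⊥)

record Graph (n : ℕ) : Set where
  field
    adj     : Fin n → Fin n → Bool
    adj-sym : ∀ i j → adj i j ≡ adj j i
    adj-irr : ∀ i → adj i i ≡ false
open Graph public

count : ∀ {n} → (Fin n → Bool) → ℕ
count {n} p = sum (map (λ i → if p i then 1 else 0) (allFin n))

degree : ∀ {n} → Graph n → Fin n → ℕ
degree G i = count (adj G i)

Regular : ∀ {n} → ℕ → Graph n → Set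
Regular d G = ∀ i → degree G i ≡ d

TriangleFree : ∀ {n} → Graph n → Set
TriangleFree G = ∀ i j k → adj G i j ≡ true → adj G j k ≡ true → adj G k i ≡ true → ⊥

_≠ᵇ_ : ∀ {n} → Fin n → Fin n → Bool
i ≠ᵇ j = not ⌊ i FinP.≟ j ⌋

sumFin : ∀ {n} → (Fin n → ℕ) → ℕ
sumFin {n} f = sum (map f (allFin n))

-- number of 4-tuples (a,b,c,e) of pairwise distinct vertices with
-- a~b, b~c, c~e, e~a  (each 4-cycle subgraph is traced by exactly 8 of them)
labelled4Cycles : ∀ {n} → Graph n → ℕ
labelled4Cycles G =
  sumFin λ a → sumFin λ b → sumFin λ c → count λ e →
    (a ≠ᵇ b) ∧ (a ≠ᵇ c) ∧ (a ≠ᵇ e) ∧ (b ≠ᵇ c) ∧ (b ≠ᵇ e) ∧ (c ≠ᵇ e) ∧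
    adj G a b ∧ adj G b c ∧ adj G c e ∧ adj G e a

-- c₄(G): number of (not necessarily induced) subgraphs isomorphic to C₄
c4 : ∀ {n} → Graph n → ℕ
c4 G = labelled4Cycles G / 8

-- (n / 2d) K_{d,d} on vertex set Fin n (meaningful when 2d ∣ n, d ≥ 1):
-- vertex i lies in block i / 2d, on side "i mod 2d < d";
-- two vertices are adjacent iff same block and opposite sides.
KddUnion : (n d : ℕ) → Graph n
KddUnion n zero = record { adj = λ _ _ → false ; adj-sym = λ _ _ → refl ; adj-irr = λ _ → refl }
KddUnion n (suc k) = record { adj = A ; adj-sym = S ; adj-irr = I }
  where
  m : ℕ
  m = 2 * suc k
  block : Fin n → ℕ
  block i = toℕ i / m
  side : Fin n → Bool
  side i = (toℕ i % m) <ᵇ suc k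
  A : Fin n → Fin n → Bool
  A i j = ⌊ block i ≟ block j ⌋ ∧ (side i xor side j)
  S : ∀ i j → A i j ≡ A j i
  S i j with block i ≟ block j | block j ≟ block i
  ... | yes _ | yes _ = xor-comm (side i) (side j)
  ... | no _  | no _  = refl
  ... | yes p | no q  with q (sym p)
  ... | ()
  S i j | no q | yes p with q (sym p)
  ... | ()
  I : ∀ i → A i i ≡ false
  I i with block i ≟ block i
  ... | yes _ = xor-same (side i)
  ... | no _ = refl

_≅_ : ∀ {n} → Graph n → Graph n → Set
_≅_ {n} G H = Σ (Fin n ↔ Fin n) λ f →
  ∀ i j → adj G i j ≡ adj H (Inverse.to f i) (Inverse.to f j)

module Submission where

-- Count labelled 4-cycles a b c e by their diagonal (a, c): a pair a ≠ c with t common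
-- neighbours carries t (t − 1) of them. In a d-regular graph t ≤ d, and double counting
-- gives Σ_{c ≠ a} t(a, c) = d (d − 1), so there are at most n d (d − 1)² labelled 4-cycles,
-- with equality iff every codegree is 0 or d; (n/2d) K_{d,d} attains the bound.
-- Conversely, if all codegrees are 0 or d then two vertices with a common neighbour are
-- twins, so "twins or adjacent" is an equivalence whose classes are copies of K_{d,d};
-- numbering blocks, sides and vertices within a side matches G with (n/2d) K_{d,d}.

open import Algebra.Bundles using (CommutativeMonoid)
open import Data.Bool using (Bool; true; false; _∧_; _xor_; not; if_then_else_)
open import Data.Bool.Properties
  using (¬-not; ∧-idem; ∧-comm; ∧-zeroʳ; ∧-identityʳ; ∧-conicalˡ; ∧-conicalʳ; ⇔→≡; ∧-commutativeMonoid)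
open import Data.Fin using (Fin; zero; suc; toℕ; fromℕ<)
import Data.Fin.Properties as FinP
import Data.List as List using (tabulate)
open import Data.List.Properties using (map-tabulate)
open import Data.Nat using (ℕ; zero; suc; _+_; _*_; _∸_; _≤_; _<_; _<ᵇ_; _/_; _%_; z≤n; s≤s; NonZero)
open import Data.Nat.DivMod
open import Data.Nat.Divisibility
  using (_∣_; divides; n∣m*n; m∣m*n; ∣-refl; ∣-trans; *-pres-∣; *-monoˡ-∣; ∣m∣n⇒∣m+n)
import Data.Nat.ListAction as List using (sum)
open import Data.Nat.Properties
open import Data.Nat.Tactic.RingSolver using (solve-∀)
open import Data.Product using (Σ; ∃; ∃₂; _×_; _,_; proj₁; proj₂)
open import Data.Sum using (_⊎_; inj₁; inj₂; [_,_]′)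
open import Function using (_∘_; id)
open import Function.Bundles using (mk⇔; _⇔_; _↔_; Inverse; mk↔ₛ′)
open import Relation.Binary.PropositionalEquality hiding ([_])
open import Relation.Nullary using (¬_; Dec; contradiction)
open import Relation.Nullary.Decidable using (yes; no; ⌊_⌋; ⌊⌋-map′; _⊎-dec_)
open import Algebra.Properties.CommutativeSemigroup (CommutativeMonoid.commutativeSemigroup ∧-commutativeMonoid)
  using () renaming (x∙yz≈y∙xz to ∧-left-comm)
open import Algebra.Properties.Semiring.Sum +-*-semiring
  using (sum; sum-cong-≗; sum-permute; ∑-comm; *-distribˡ-sum; *-distribʳ-sum)

open import Defs

[_] : Bool → ℕ
[ b ] = if b then 1 else 0

[]-mono : ∀ {b c} → (b ≡ true → c ≡ true) → [ b ] ≤ [ c ]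
[]-mono {false} b⇒c = z≤n
[]-mono {true} b⇒c rewrite b⇒c refl = ≤-refl

[]-injective : ∀ {b c} → [ b ] ≡ [ c ] → b ≡ c
[]-injective {false} {false} _ = refl
[]-injective {true} {true} _ = refl

[]-∧ : ∀ x y → [ x ∧ y ] ≡ [ x ] * [ y ]
[]-∧ false y = refl
[]-∧ true y = sym (+-identityʳ [ y ])

[]-*-cong : ∀ b {x y} → (b ≡ true → x ≡ y) → [ b ] * x ≡ [ b ] * y
[]-*-cong false _ = refl
[]-*-cong true x≡y = cong (1 *_) (x≡y refl)

[]-*-cancelˡ : ∀ {b x y} → b ≡ true → [ b ] * x ≡ [ b ] * y → x ≡ y
[]-*-cancelˡ refl eq = *-cancelˡ-≡ _ _ 1 eq

∧-true : ∀ x {y} → x ∧ y ≡ true → x ≡ true × y ≡ true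
∧-true x {y} xy = ∧-conicalˡ x y xy , ∧-conicalʳ x y xy

xor-true⇒≡ : ∀ x y z → (x xor z) ∧ (y xor z) ≡ true → x ≡ y
xor-true⇒≡ false false _ _ = refl
xor-true⇒≡ true true _ _ = refl
xor-true⇒≡ false true false ()
xor-true⇒≡ false true true ()
xor-true⇒≡ true false false ()
xor-true⇒≡ true false true ()

⌊⌋≡true : ∀ {p} {P : Set p} (p? : Dec P) → P → ⌊ p? ⌋ ≡ true
⌊⌋≡true (yes _) _ = refl
⌊⌋≡true (no ¬p) p = contradiction p ¬p

⌊⌋≡false : ∀ {p} {P : Set p} (p? : Dec P) → ¬ P → ⌊ p? ⌋ ≡ false
⌊⌋≡false (yes p) ¬p = contradiction p ¬p
⌊⌋≡false (no _) _ = refl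

⌊⌋≡true⇒ : ∀ {p} {P : Set p} (p? : Dec P) → ⌊ p? ⌋ ≡ true → P
⌊⌋≡true⇒ (yes p) _ = p

⌊suc≟suc⌋ : ∀ a b → ⌊ suc a ≟ suc b ⌋ ≡ ⌊ a ≟ b ⌋
⌊suc≟suc⌋ a b = trans (⌊⌋-map′ _ _ _) (sym (⌊⌋-map′ _ _ _))

≠ᵇ-suc : ∀ {n} (b e : Fin n) → (suc b ≠ᵇ suc e) ≡ (b ≠ᵇ e)
≠ᵇ-suc b e = cong not (⌊⌋-map′ (cong suc) FinP.suc-injective (b FinP.≟ e))

≢⇒≠ᵇ : ∀ {n} {x y : Fin n} → x ≢ y → (x ≠ᵇ y) ≡ true
≢⇒≠ᵇ {x = x} {y} x≢y = cong not (⌊⌋≡false (x FinP.≟ y) x≢y)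

<⇒<ᵇ≡true : ∀ {m n} → m < n → (m <ᵇ n) ≡ true
<⇒<ᵇ≡true {zero} {suc n} _ = refl
<⇒<ᵇ≡true {suc m} {suc n} (s≤s m<n) = <⇒<ᵇ≡true m<n

≥⇒<ᵇ≡false : ∀ {m n} → n ≤ m → (m <ᵇ n) ≡ false
≥⇒<ᵇ≡false {m} {zero} _ = refl
≥⇒<ᵇ≡false {suc m} {suc n} (s≤s n≤m) = ≥⇒<ᵇ≡false n≤m

m*[m∸1]≡m*[d∸1]⇒m≡0⊎m≡d : ∀ {m d} → m ≤ d → m * (m ∸ 1) ≡ m * (d ∸ 1) → m ≡ 0 ⊎ m ≡ d
m*[m∸1]≡m*[d∸1]⇒m≡0⊎m≡d {zero} _ _ = inj₁ refl
m*[m∸1]≡m*[d∸1]⇒m≡0⊎m≡d {suc m} {suc d} (s≤s m≤d) eq = inj₂ (cong suc (*-cancelˡ-≡ m d (suc m) eq))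

[r+kn]/n≡k : ∀ {r} k n .{{_ : NonZero n}} → r < n → (r + k * n) / n ≡ k
[r+kn]/n≡k {r} k n r<n = begin
  (r + k * n) / n        ≡⟨ +-distrib-/-∣ʳ r (n∣m*n k) ⟩
  r / n + k * n / n      ≡⟨ cong₂ _+_ (m<n⇒m/n≡0 r<n) (m*n/n≡m k n) ⟩
  k                      ∎
  where open ≡-Reasoning

[r+kn]%n≡r : ∀ {r} k n .{{_ : NonZero n}} → r < n → (r + k * n) % n ≡ r
[r+kn]%n≡r {r} k n r<n = trans ([m+kn]%n≡m%n r k n) (m<n⇒m%n≡m r<n)

2∣n*[n∸1] : ∀ n → 2 ∣ n * (n ∸ 1)
2∣n*[n∸1] zero = divides 0 refl
2∣n*[n∸1] (suc zero) = divides 0 refl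
2∣n*[n∸1] (suc (suc n)) = subst (2 ∣_) (step n) (∣m∣n⇒∣m+n (2∣n*[n∸1] (suc n)) (m∣m*n (suc n)))
  where
  step : ∀ n → suc n * n + 2 * suc n ≡ suc (suc n) * suc n
  step = solve-∀

8∣n*d*[d∸1]² : ∀ {n} d → 2 * d ∣ n → 8 ∣ n * (d * (d ∸ 1) * (d ∸ 1))
8∣n*d*[d∸1]² d 2d∣n = ∣-trans 8∣2d*rest (*-monoˡ-∣ (d * (d ∸ 1) * (d ∸ 1)) 2d∣n)
  where
  regroup : ∀ d e → 2 * (d * e) * (d * e) ≡ 2 * d * (d * e * e)
  regroup = solve-∀
  8∣2d*rest : 8 ∣ 2 * d * (d * (d ∸ 1) * (d ∸ 1))
  8∣2d*rest = subst (8 ∣_) (regroup d (d ∸ 1))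
    (*-pres-∣ (*-pres-∣ (∣-refl {2}) (2∣n*[n∸1] d)) (2∣n*[n∸1] d))

sumFin≡sum : ∀ {n} (f : Fin n → ℕ) → sumFin f ≡ sum f
sumFin≡sum f = trans (cong List.sum (map-tabulate id f)) (sum-tabulate f)
  where
  sum-tabulate : ∀ {n} (g : Fin n → ℕ) → List.sum (List.tabulate g) ≡ sum g
  sum-tabulate {zero} g = refl
  sum-tabulate {suc n} g = cong (g zero +_) (sum-tabulate (g ∘ suc))

sumFin³≡sum³ : ∀ {n} (f : Fin n → Fin n → Fin n → ℕ) →
  sumFin (λ a → sumFin (λ b → sumFin (f a b))) ≡ sum (λ a → sum (λ b → sum (f a b)))
sumFin³≡sum³ f = begin
  sumFin (λ a → sumFin (λ b → sumFin (f a b)))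
    ≡⟨ sumFin≡sum (λ a → sumFin (λ b → sumFin (f a b))) ⟩
  sum (λ a → sumFin (λ b → sumFin (f a b)))
    ≡⟨ sum-cong-≗ (λ a → sumFin≡sum (λ b → sumFin (f a b))) ⟩
  sum (λ a → sum (λ b → sumFin (f a b)))
    ≡⟨ sum-cong-≗ (λ a → sum-cong-≗ (λ b → sumFin≡sum (f a b))) ⟩
  sum (λ a → sum (λ b → sum (f a b))) ∎
  where open ≡-Reasoning

sum-mono-≤ : ∀ {n} {f g : Fin n → ℕ} → (∀ i → f i ≤ g i) → sum f ≤ sum g
sum-mono-≤ {zero} f≤g = z≤n
sum-mono-≤ {suc n} f≤g = +-mono-≤ (f≤g zero) (sum-mono-≤ (f≤g ∘ suc))

sum-const : ∀ n c → sum {n} (λ _ → c) ≡ n * c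
sum-const zero c = refl
sum-const (suc n) c = cong (c +_) (sum-const n c)

sum-≡⇒≗ : ∀ {n} {f g : Fin n → ℕ} → (∀ i → f i ≤ g i) → sum f ≡ sum g → ∀ i → f i ≡ g i
sum-≡⇒≗ {suc n} {f} {g} f≤g Σf≡Σg = λ where
    zero → head≡
    (suc i) → sum-≡⇒≗ (f≤g ∘ suc) tail≡ i
  where
  head≡ : f zero ≡ g zero
  head≡ = ≤-antisym (f≤g zero) (+-cancelʳ-≤ (sum (f ∘ suc)) (g zero) (f zero) (begin
    g zero + sum (f ∘ suc) ≤⟨ +-monoʳ-≤ (g zero) (sum-mono-≤ (f≤g ∘ suc)) ⟩
    g zero + sum (g ∘ suc) ≡⟨ Σf≡Σg ⟨
    f zero + sum (f ∘ suc) ∎))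
    where open ≤-Reasoning
  tail≡ : sum (f ∘ suc) ≡ sum (g ∘ suc)
  tail≡ = +-cancelˡ-≡ (f zero) _ _ (trans Σf≡Σg (cong (_+ sum (g ∘ suc)) (sym head≡)))

count≡sum : ∀ {n} (p : Fin n → Bool) → count p ≡ sum (λ i → [ p i ])
count≡sum p = sumFin≡sum (λ i → [ p i ])

count-suc : ∀ {n} (p : Fin (suc n) → Bool) → count p ≡ [ p zero ] + count (p ∘ suc)
count-suc p = trans (count≡sum p) (cong ([ p zero ] +_) (sym (count≡sum (p ∘ suc))))

count-cong : ∀ {n} {p q : Fin n → Bool} → (∀ i → p i ≡ q i) → count p ≡ count q
count-cong {p = p} {q} p≗q = begin
  count p              ≡⟨ count≡sum p ⟩
  sum (λ i → [ p i ])  ≡⟨ sum-cong-≗ (cong [_] ∘ p≗q) ⟩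
  sum (λ i → [ q i ])  ≡⟨ count≡sum q ⟨
  count q              ∎
  where open ≡-Reasoning

count-false : ∀ {n} (p : Fin n → Bool) → (∀ i → p i ≡ false) → count p ≡ 0
count-false {n} p p≗false = begin
  count p               ≡⟨ count-cong p≗false ⟩
  count {n} (λ _ → false) ≡⟨ count≡sum {n} (λ _ → false) ⟩
  sum {n} (λ _ → 0)     ≡⟨ sum-const n 0 ⟩
  n * 0                 ≡⟨ *-zeroʳ n ⟩
  0                     ∎
  where open ≡-Reasoning

count-mono : ∀ {n} {p q : Fin n → Bool} → (∀ i → p i ≡ true → q i ≡ true) → count p ≤ count q
count-mono {p = p} {q} p⇒q = begin
  count p              ≡⟨ count≡sum p ⟩
  sum (λ i → [ p i ])  ≤⟨ sum-mono-≤ (λ i → []-mono (p⇒q i)) ⟩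
  sum (λ i → [ q i ])  ≡⟨ count≡sum q ⟨
  count q              ∎
  where open ≤-Reasoning

count-≡⇒⊇ : ∀ {n} {p q : Fin n → Bool} → (∀ i → p i ≡ true → q i ≡ true) →
  count p ≡ count q → ∀ i → q i ≡ true → p i ≡ true
count-≡⇒⊇ {p = p} {q} p⇒q #p≡#q i qi = trans p≡q qi
  where
  p≡q : p i ≡ q i
  p≡q = []-injective (sum-≡⇒≗ (λ j → []-mono (p⇒q j))
    (trans (sym (count≡sum p)) (trans #p≡#q (count≡sum q))) i)

count-∧ˡ : ∀ {n} (t : Bool) (q : Fin n → Bool) → count (λ i → t ∧ q i) ≡ [ t ] * count q
count-∧ˡ {n} false q = count-false {n} (λ _ → false) (λ _ → refl)
count-∧ˡ true q = sym (*-identityˡ (count q))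

count-remove : ∀ {n} (q : Fin n → Bool) (b : Fin n) → q b ≡ true →
  count (λ e → (b ≠ᵇ e) ∧ q e) + 1 ≡ count q
count-remove {suc n} q zero qb = begin
  count (λ e → (zero ≠ᵇ e) ∧ q e) + 1  ≡⟨ cong (_+ 1) (count-suc (λ e → (zero ≠ᵇ e) ∧ q e)) ⟩
  count (q ∘ suc) + 1                  ≡⟨ +-comm _ 1 ⟩
  [ true ] + count (q ∘ suc)           ≡⟨ cong (λ t → [ t ] + count (q ∘ suc)) qb ⟨
  [ q zero ] + count (q ∘ suc)         ≡⟨ count-suc q ⟨
  count q                              ∎
  where open ≡-Reasoning
count-remove {suc n} q (suc b) qb = begin
  count (λ e → (suc b ≠ᵇ e) ∧ q e) + 1
    ≡⟨ cong (_+ 1) (count-suc (λ e → (suc b ≠ᵇ e) ∧ q e)) ⟩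
  [ q zero ] + count (λ e → (suc b ≠ᵇ suc e) ∧ q (suc e)) + 1
    ≡⟨ cong (λ c → [ q zero ] + c + 1) (count-cong (λ e → cong (_∧ q (suc e)) (≠ᵇ-suc b e))) ⟩
  [ q zero ] + count (λ e → (b ≠ᵇ e) ∧ q (suc e)) + 1
    ≡⟨ +-assoc [ q zero ] _ 1 ⟩
  [ q zero ] + (count (λ e → (b ≠ᵇ e) ∧ q (suc e)) + 1)
    ≡⟨ cong ([ q zero ] +_) (count-remove (q ∘ suc) b qb) ⟩
  [ q zero ] + count (q ∘ suc)
    ≡⟨ count-suc q ⟨
  count q ∎
  where open ≡-Reasoning

count-remove-∸ : ∀ {n} (q : Fin n → Bool) (b : Fin n) → q b ≡ true →
  count (λ e → (b ≠ᵇ e) ∧ q e) ≡ count q ∸ 1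
count-remove-∸ q b qb = trans (sym (m+n∸n≡m _ 1)) (cong (_∸ 1) (count-remove q b qb))

count-pos : ∀ {n} (q : Fin n → Bool) (b : Fin n) → q b ≡ true → 0 < count q
count-pos q b qb = subst (0 <_) (trans (+-comm 1 _) (count-remove q b qb)) (s≤s z≤n)

count-permute : ∀ {n} (π : Fin n ↔ Fin n) (q : Fin n → Bool) → count (q ∘ Inverse.to π) ≡ count q
count-permute π q = begin
  count (q ∘ Inverse.to π)                 ≡⟨ count≡sum (q ∘ Inverse.to π) ⟩
  sum (λ i → [ q (Inverse.to π i) ])       ≡⟨ sum-permute (λ i → [ q i ]) π ⟨
  sum (λ i → [ q i ])                      ≡⟨ count≡sum q ⟨
  count q                                  ∎
  where open ≡-Reasoning

rank : ∀ {n} → (Fin n → Bool) → Fin n → ℕ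
rank p v = count (λ u → p u ∧ (toℕ u <ᵇ toℕ v))

rank-cong : ∀ {n} {p q : Fin n → Bool} → (∀ i → p i ≡ q i) → ∀ v → rank p v ≡ rank q v
rank-cong p≗q v = count-cong (λ u → cong (_∧ (toℕ u <ᵇ toℕ v)) (p≗q u))

rank-zero : ∀ {n} (p : Fin (suc n) → Bool) → rank p zero ≡ 0
rank-zero p = count-false (λ u → p u ∧ false) (λ u → ∧-zeroʳ (p u))

rank-suc : ∀ {n} (p : Fin (suc n) → Bool) (v : Fin n) → rank p (suc v) ≡ [ p zero ] + rank (p ∘ suc) v
rank-suc p v = trans (count-suc (λ u → p u ∧ (toℕ u <ᵇ toℕ (suc v))))
                     (cong (λ t → [ t ] + rank (p ∘ suc) v) (∧-identityʳ (p zero)))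

rank-suc≢0 : ∀ {n} (p : Fin (suc n) → Bool) (v : Fin n) → p zero ≡ true → rank p (suc v) ≢ 0
rank-suc≢0 p v p0 r≡0 with () ← trans (sym r≡0) (trans (rank-suc p v) (cong (λ t → [ t ] + rank (p ∘ suc) v) p0))

rank<count : ∀ {n} (p : Fin n → Bool) {v} → p v ≡ true → rank p v < count p
rank<count p {zero} pv = begin-strict
  rank p zero                   ≡⟨ rank-zero p ⟩
  0                             <⟨ count-pos p zero pv ⟩
  count p                       ∎
  where open ≤-Reasoning
rank<count p {suc v} pv = begin-strict
  rank p (suc v)                ≡⟨ rank-suc p v ⟩
  [ p zero ] + rank (p ∘ suc) v <⟨ +-monoʳ-< [ p zero ] (rank<count (p ∘ suc) pv) ⟩
  [ p zero ] + count (p ∘ suc)  ≡⟨ count-suc p ⟨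
  count p                       ∎
  where open ≤-Reasoning

rank-injective : ∀ {n} (p : Fin n → Bool) {u v} → p u ≡ true → p v ≡ true → rank p u ≡ rank p v → u ≡ v
rank-injective p {zero} {zero} _ _ _ = refl
rank-injective p {zero} {suc v} pu _ ru≡rv = contradiction (trans (sym ru≡rv) (rank-zero p)) (rank-suc≢0 p v pu)
rank-injective p {suc u} {zero} _ pv ru≡rv = contradiction (trans ru≡rv (rank-zero p)) (rank-suc≢0 p u pv)
rank-injective p {suc u} {suc v} pu pv ru≡rv = cong suc (rank-injective (p ∘ suc) pu pv
  (+-cancelˡ-≡ [ p zero ] _ _ (trans (sym (rank-suc p u)) (trans ru≡rv (rank-suc p v)))))

rank-surjective : ∀ {n} (p : Fin n → Bool) {k} → k < count p → ∃ λ v → p v ≡ true × rank p v ≡ k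
rank-surjective {suc n} p {k} k<#p = go (p zero) refl k (subst (k <_) (count-suc p) k<#p)
  where
  go : ∀ b → p zero ≡ b → ∀ k → k < [ b ] + count (p ∘ suc) → ∃ λ v → p v ≡ true × rank p v ≡ k
  go true p0 zero _ = zero , p0 , rank-zero p
  go true p0 (suc k) (s≤s k<#p) with v , pv , rv ← rank-surjective (p ∘ suc) k<#p =
    suc v , pv , trans (rank-suc p v) (cong₂ _+_ (cong [_] p0) rv)
  go false p0 k k<#p with v , pv , rv ← rank-surjective (p ∘ suc) k<#p =
    suc v , pv , trans (rank-suc p v) (cong₂ _+_ (cong [_] p0) rv)

injection-onto⇒↔ : ∀ {n N} (φ : Fin n → ℕ) → (∀ {u v} → φ u ≡ φ v → u ≡ v) →
  (∀ v → φ v < N) → (∀ y → y < N → ∃ λ v → φ v ≡ y) →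
  Σ (Fin n ↔ Fin n) λ π → ∀ v → toℕ (Inverse.to π v) ≡ φ v
injection-onto⇒↔ {n} {N} φ φ-injective φ<N φ-onto = mk↔ₛ′ to from to∘from from∘to , to-toℕ
  where
  preimage : Fin N → Fin n
  preimage y = proj₁ (φ-onto (toℕ y) (FinP.toℕ<n y))

  n≡N : n ≡ N
  n≡N = ≤-antisym
    (FinP.injective⇒≤ {f = λ v → fromℕ< (φ<N v)}
      (λ {u} {v} eq → φ-injective (trans (sym (FinP.toℕ-fromℕ< (φ<N u)))
                                   (trans (cong toℕ eq) (FinP.toℕ-fromℕ< (φ<N v))))))
    (FinP.injective⇒≤ {f = preimage}
      (λ {x} {y} eq → FinP.toℕ-injective (trans (sym (proj₂ (φ-onto (toℕ x) _)))
                                          (trans (cong φ eq) (proj₂ (φ-onto (toℕ y) _))))))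

  φ<n : ∀ v → φ v < n
  φ<n v = subst (φ v <_) (sym n≡N) (φ<N v)

  to : Fin n → Fin n
  to v = fromℕ< (φ<n v)

  to-toℕ : ∀ v → toℕ (to v) ≡ φ v
  to-toℕ v = FinP.toℕ-fromℕ< (φ<n v)

  from-spec : ∀ y → ∃ λ v → φ v ≡ toℕ y
  from-spec y = φ-onto (toℕ y) (subst (toℕ y <_) n≡N (FinP.toℕ<n y))

  from : Fin n → Fin n
  from y = proj₁ (from-spec y)

  to∘from : ∀ y → to (from y) ≡ y
  to∘from y = FinP.toℕ-injective (trans (to-toℕ (from y)) (proj₂ (from-spec y)))

  from∘to : ∀ v → from (to v) ≡ v
  from∘to v = φ-injective (trans (proj₂ (from-spec (to v))) (to-toℕ v))

countBelow : ℕ → (ℕ → Bool) → ℕ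
countBelow zero Q = 0
countBelow (suc N) Q = [ Q 0 ] + countBelow N (Q ∘ suc)

count∘toℕ : ∀ {N} (Q : ℕ → Bool) → count {N} (Q ∘ toℕ) ≡ countBelow N Q
count∘toℕ {zero} Q = refl
count∘toℕ {suc N} Q = trans (count-suc {N} (Q ∘ toℕ)) (cong ([ Q 0 ] +_) (count∘toℕ {N} (Q ∘ suc)))

countBelow-cong : ∀ N {Q R : ℕ → Bool} → (∀ r → r < N → Q r ≡ R r) → countBelow N Q ≡ countBelow N R
countBelow-cong zero Q≗R = refl
countBelow-cong (suc N) Q≗R =
  cong₂ _+_ (cong [_] (Q≗R 0 (s≤s z≤n))) (countBelow-cong N (λ r r<N → Q≗R (suc r) (s≤s r<N)))

countBelow-+ : ∀ M N (Q : ℕ → Bool) → countBelow (M + N) Q ≡ countBelow M Q + countBelow N (λ r → Q (M + r))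
countBelow-+ zero N Q = refl
countBelow-+ (suc M) N Q = trans (cong ([ Q 0 ] +_) (countBelow-+ M N (Q ∘ suc))) (sym (+-assoc [ Q 0 ] _ _))

countBelow-const : ∀ N b → countBelow N (λ _ → b) ≡ N * [ b ]
countBelow-const zero b = refl
countBelow-const (suc N) b = cong ([ b ] +_) (countBelow-const N b)

countBelow-halves : ∀ d s → countBelow (d + d) (λ r → s xor (r <ᵇ d)) ≡ d
countBelow-halves d s = begin
  countBelow (d + d) (λ r → s xor (r <ᵇ d))
    ≡⟨ countBelow-+ d d (λ r → s xor (r <ᵇ d)) ⟩
  countBelow d (λ r → s xor (r <ᵇ d)) + countBelow d (λ r → s xor (d + r <ᵇ d))
    ≡⟨ cong₂ _+_ (countBelow-cong d (λ r r<d → cong (s xor_) (<⇒<ᵇ≡true r<d)))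
                 (countBelow-cong d (λ r _ → cong (s xor_) (≥⇒<ᵇ≡false (m≤m+n d r)))) ⟩
  countBelow d (λ _ → s xor true) + countBelow d (λ _ → s xor false)
    ≡⟨ cong₂ _+_ (countBelow-const d (s xor true)) (countBelow-const d (s xor false)) ⟩
  d * [ s xor true ] + d * [ s xor false ]
    ≡⟨ *-distribˡ-+ d [ s xor true ] [ s xor false ] ⟨
  d * ([ s xor true ] + [ s xor false ])
    ≡⟨ cong (d *_) (halves s) ⟩
  d * 1
    ≡⟨ *-identityʳ d ⟩
  d ∎
  where
  open ≡-Reasoning
  halves : ∀ s → [ s xor true ] + [ s xor false ] ≡ 1
  halves false = refl
  halves true = refl

-- Labelled 4-cycles and codegrees

module _ {n} (G : Graph n) where

  codegree : Fin n → Fin n → ℕ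
  codegree a c = count (λ e → adj G a e ∧ adj G c e)

  diagonalCycles : Fin n → Fin n → ℕ
  diagonalCycles a c = [ a ≠ᵇ c ] * (codegree a c * (codegree a c ∸ 1))

  adj-flip : ∀ {x y} → adj G x y ≡ true → adj G y x ≡ true
  adj-flip {x} {y} xy = trans (adj-sym G y x) xy

  adj⇒≠ᵇ : ∀ {x y} → adj G x y ≡ true → (x ≠ᵇ y) ≡ true
  adj⇒≠ᵇ {x} xy = ≢⇒≠ᵇ λ { refl → contradiction (trans (sym xy) (adj-irr G x)) λ () }

  wedge : Fin n → Fin n → Fin n → Bool
  wedge a b c = (a ≠ᵇ c) ∧ (adj G a b ∧ adj G c b)

  isLabelled4Cycle : Fin n → Fin n → Fin n → Fin n → Bool
  isLabelled4Cycle a b c e =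
    (a ≠ᵇ b) ∧ (a ≠ᵇ c) ∧ (a ≠ᵇ e) ∧ (b ≠ᵇ c) ∧ (b ≠ᵇ e) ∧ (c ≠ᵇ e) ∧
    adj G a b ∧ adj G b c ∧ adj G c e ∧ adj G e a

  isLabelled4Cycle≡ : ∀ a b c e →
    isLabelled4Cycle a b c e ≡ wedge a b c ∧ ((b ≠ᵇ e) ∧ (adj G a e ∧ adj G c e))
  isLabelled4Cycle≡ a b c e = ⇔→≡ (mk⇔ split join)
    where
    split : isLabelled4Cycle a b c e ≡ true → wedge a b c ∧ ((b ≠ᵇ e) ∧ (adj G a e ∧ adj G c e)) ≡ true
    split cyc
      with _   , cyc ← ∧-true (a ≠ᵇ b) cyc
      with a≢c , cyc ← ∧-true (a ≠ᵇ c) cyc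
      with _   , cyc ← ∧-true (a ≠ᵇ e) cyc
      with _   , cyc ← ∧-true (b ≠ᵇ c) cyc
      with b≢e , cyc ← ∧-true (b ≠ᵇ e) cyc
      with _   , cyc ← ∧-true (c ≠ᵇ e) cyc
      with ab  , cyc ← ∧-true (adj G a b) cyc
      with bc  , cyc ← ∧-true (adj G b c) cyc
      with ce  , ea  ← ∧-true (adj G c e) cyc
      rewrite a≢c | ab | adj-flip bc | b≢e | adj-flip ea | ce = refl
    join : wedge a b c ∧ ((b ≠ᵇ e) ∧ (adj G a e ∧ adj G c e)) ≡ true → isLabelled4Cycle a b c e ≡ true
    join w
      with abc , abe ← ∧-true (wedge a b c) w
      with a≢c , abc ← ∧-true (a ≠ᵇ c) abc
      with ab  , cb  ← ∧-true (adj G a b) abc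
      with b≢e , abe ← ∧-true (b ≠ᵇ e) abe
      with ae  , ce  ← ∧-true (adj G a e) abe
      rewrite adj⇒≠ᵇ ab | a≢c | adj⇒≠ᵇ ae | adj⇒≠ᵇ (adj-flip cb) | b≢e | adj⇒≠ᵇ ce
            | ab | adj-flip cb | ce | adj-flip ae = refl

  count-4cycles-through-wedge : ∀ a b c →
    count (isLabelled4Cycle a b c) ≡ [ wedge a b c ] * (codegree a c ∸ 1)
  count-4cycles-through-wedge a b c = begin
    count (isLabelled4Cycle a b c)
      ≡⟨ count-cong (isLabelled4Cycle≡ a b c) ⟩
    count (λ e → wedge a b c ∧ ((b ≠ᵇ e) ∧ (adj G a e ∧ adj G c e)))
      ≡⟨ count-∧ˡ (wedge a b c) (λ e → (b ≠ᵇ e) ∧ (adj G a e ∧ adj G c e)) ⟩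
    [ wedge a b c ] * count (λ e → (b ≠ᵇ e) ∧ (adj G a e ∧ adj G c e))
      ≡⟨ []-*-cong (wedge a b c) (λ abc → count-remove-∸ (λ e → adj G a e ∧ adj G c e) b (common abc)) ⟩
    [ wedge a b c ] * (codegree a c ∸ 1) ∎
    where
    open ≡-Reasoning
    common : wedge a b c ≡ true → adj G a b ∧ adj G c b ≡ true
    common = proj₂ ∘ ∧-true (a ≠ᵇ c)

  sum-wedge : ∀ a c k → sum (λ b → [ wedge a b c ] * k) ≡ [ a ≠ᵇ c ] * (codegree a c * k)
  sum-wedge a c k = begin
    sum (λ b → [ wedge a b c ] * k)   ≡⟨ *-distribʳ-sum k (λ b → [ wedge a b c ]) ⟨
    sum (λ b → [ wedge a b c ]) * k   ≡⟨ cong (_* k) (count≡sum (λ b → wedge a b c)) ⟨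
    count (λ b → wedge a b c) * k     ≡⟨ cong (_* k) (count-∧ˡ (a ≠ᵇ c) (λ b → adj G a b ∧ adj G c b)) ⟩
    [ a ≠ᵇ c ] * codegree a c * k     ≡⟨ *-assoc [ a ≠ᵇ c ] (codegree a c) k ⟩
    [ a ≠ᵇ c ] * (codegree a c * k)   ∎
    where open ≡-Reasoning

  labelled4Cycles≡∑diagonalCycles : labelled4Cycles G ≡ sum (λ a → sum (diagonalCycles a))
  labelled4Cycles≡∑diagonalCycles = begin
    labelled4Cycles G
      ≡⟨ sumFin³≡sum³ (λ a b c → count (isLabelled4Cycle a b c)) ⟩
    sum (λ a → sum (λ b → sum (λ c → count (isLabelled4Cycle a b c))))
      ≡⟨ sum-cong-≗ (λ a → sum-cong-≗ (λ b → sum-cong-≗ (count-4cycles-through-wedge a b))) ⟩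
    sum (λ a → sum (λ b → sum (λ c → [ wedge a b c ] * (codegree a c ∸ 1))))
      ≡⟨ sum-cong-≗ (λ a → ∑-comm (λ b c → [ wedge a b c ] * (codegree a c ∸ 1))) ⟩
    sum (λ a → sum (λ c → sum (λ b → [ wedge a b c ] * (codegree a c ∸ 1))))
      ≡⟨ sum-cong-≗ (λ a → sum-cong-≗ (λ c → sum-wedge a c (codegree a c ∸ 1))) ⟩
    sum (λ a → sum (diagonalCycles a)) ∎
    where open ≡-Reasoning

CodegreeDichotomy : ∀ {n} → ℕ → Graph n → Set
CodegreeDichotomy d G = ∀ a c → a ≢ c → codegree G a c ≡ 0 ⊎ codegree G a c ≡ d

module _ {n} (G : Graph n) {d} (regular : Regular d G) where

  codegree≤ : ∀ a c → codegree G a c ≤ d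
  codegree≤ a c = ≤-trans (count-mono (λ e → proj₁ ∘ ∧-true (adj G a e))) (≤-reflexive (regular a))

  codegree≡d⇒⊆ : ∀ {a c} → codegree G a c ≡ d → ∀ e → adj G a e ≡ true → adj G c e ≡ true
  codegree≡d⇒⊆ {a} {c} cd≡d e ae = proj₂ (∧-true (adj G a e)
    (count-≡⇒⊇ (λ e → proj₁ ∘ ∧-true (adj G a e)) (trans cd≡d (sym (regular a))) e ae))

  count-partners-through : ∀ a e →
    count (λ c → (a ≠ᵇ c) ∧ (adj G a e ∧ adj G c e)) ≡ [ adj G a e ] * (d ∸ 1)
  count-partners-through a e = begin
    count (λ c → (a ≠ᵇ c) ∧ (adj G a e ∧ adj G c e))
      ≡⟨ count-cong (λ c → trans (∧-left-comm (a ≠ᵇ c) (adj G a e) (adj G c e))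
                                  (cong (λ x → adj G a e ∧ ((a ≠ᵇ c) ∧ x)) (adj-sym G c e))) ⟩
    count (λ c → adj G a e ∧ ((a ≠ᵇ c) ∧ adj G e c))
      ≡⟨ count-∧ˡ (adj G a e) (λ c → (a ≠ᵇ c) ∧ adj G e c) ⟩
    [ adj G a e ] * count (λ c → (a ≠ᵇ c) ∧ adj G e c)
      ≡⟨ []-*-cong (adj G a e) (λ ae → trans (count-remove-∸ (adj G e) a (adj-flip G ae))
                                              (cong (_∸ 1) (regular e))) ⟩
    [ adj G a e ] * (d ∸ 1) ∎
    where open ≡-Reasoning

  sum-codegree : ∀ a → sum (λ c → [ a ≠ᵇ c ] * codegree G a c) ≡ d * (d ∸ 1)
  sum-codegree a = begin
    sum (λ c → [ a ≠ᵇ c ] * codegree G a c)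
      ≡⟨ sum-cong-≗ (λ c → trans (cong ([ a ≠ᵇ c ] *_) (count≡sum (λ e → adj G a e ∧ adj G c e)))
                                  (*-distribˡ-sum [ a ≠ᵇ c ] (λ e → [ adj G a e ∧ adj G c e ]))) ⟩
    sum (λ c → sum (λ e → [ a ≠ᵇ c ] * [ adj G a e ∧ adj G c e ]))
      ≡⟨ ∑-comm (λ c e → [ a ≠ᵇ c ] * [ adj G a e ∧ adj G c e ]) ⟩
    sum (λ e → sum (λ c → [ a ≠ᵇ c ] * [ adj G a e ∧ adj G c e ]))
      ≡⟨ sum-cong-≗ (λ e → trans (sum-cong-≗ (λ c → sym ([]-∧ (a ≠ᵇ c) (adj G a e ∧ adj G c e))))
                          (trans (sym (count≡sum (λ c → (a ≠ᵇ c) ∧ (adj G a e ∧ adj G c e))))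
                                 (count-partners-through a e))) ⟩
    sum (λ e → [ adj G a e ] * (d ∸ 1))
      ≡⟨ *-distribʳ-sum (d ∸ 1) (λ e → [ adj G a e ]) ⟨
    sum (λ e → [ adj G a e ]) * (d ∸ 1)
      ≡⟨ cong (_* (d ∸ 1)) (trans (sym (count≡sum (adj G a))) (regular a)) ⟩
    d * (d ∸ 1) ∎
    where open ≡-Reasoning

  private
    diagonalBound : Fin n → Fin n → ℕ
    diagonalBound a c = [ a ≠ᵇ c ] * (codegree G a c * (d ∸ 1))

    diagonalCycles≤bound : ∀ a c → diagonalCycles G a c ≤ diagonalBound a c
    diagonalCycles≤bound a c = *-monoʳ-≤ [ a ≠ᵇ c ] (*-monoʳ-≤ (codegree G a c) (∸-monoˡ-≤ 1 (codegree≤ a c)))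

    sum-diagonalBound : sum (λ a → sum (diagonalBound a)) ≡ n * (d * (d ∸ 1) * (d ∸ 1))
    sum-diagonalBound = begin
      sum (λ a → sum (diagonalBound a))
        ≡⟨ sum-cong-≗ (λ a → sum-cong-≗ (λ c → *-assoc [ a ≠ᵇ c ] (codegree G a c) (d ∸ 1))) ⟨
      sum (λ a → sum (λ c → [ a ≠ᵇ c ] * codegree G a c * (d ∸ 1)))
        ≡⟨ sum-cong-≗ (λ a → *-distribʳ-sum (d ∸ 1) (λ c → [ a ≠ᵇ c ] * codegree G a c)) ⟨
      sum (λ a → sum (λ c → [ a ≠ᵇ c ] * codegree G a c) * (d ∸ 1))
        ≡⟨ sum-cong-≗ (λ a → cong (_* (d ∸ 1)) (sum-codegree a)) ⟩
      sum {n} (λ _ → d * (d ∸ 1) * (d ∸ 1))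
        ≡⟨ sum-const n _ ⟩
      n * (d * (d ∸ 1) * (d ∸ 1)) ∎
      where open ≡-Reasoning

    diagonalCycles≡bound⇒ : ∀ a c → a ≢ c → diagonalCycles G a c ≡ diagonalBound a c →
      codegree G a c ≡ 0 ⊎ codegree G a c ≡ d
    diagonalCycles≡bound⇒ a c a≢c eq =
      m*[m∸1]≡m*[d∸1]⇒m≡0⊎m≡d (codegree≤ a c) ([]-*-cancelˡ (≢⇒≠ᵇ a≢c) eq)

    dichotomy⇒diagonalCycles≡bound : CodegreeDichotomy d G → ∀ a c → diagonalCycles G a c ≡ diagonalBound a c
    dichotomy⇒diagonalCycles≡bound dichotomy a c with a FinP.≟ c
    ... | yes refl = refl
    ... | no a≢c with dichotomy a c a≢c
    ...   | inj₁ cd≡0 rewrite cd≡0 = refl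
    ...   | inj₂ cd≡d rewrite cd≡d = refl

  labelled4Cycles-≤ : labelled4Cycles G ≤ n * (d * (d ∸ 1) * (d ∸ 1))
  labelled4Cycles-≤ = begin
    labelled4Cycles G          ≡⟨ labelled4Cycles≡∑diagonalCycles G ⟩
    sum (λ a → sum (diagonalCycles G a))   ≤⟨ sum-mono-≤ (λ a → sum-mono-≤ (diagonalCycles≤bound a)) ⟩
    sum (λ a → sum (diagonalBound a))  ≡⟨ sum-diagonalBound ⟩
    n * (d * (d ∸ 1) * (d ∸ 1)) ∎
    where open ≤-Reasoning

  labelled4Cycles-≡⇒dichotomy : labelled4Cycles G ≡ n * (d * (d ∸ 1) * (d ∸ 1)) → CodegreeDichotomy d G
  labelled4Cycles-≡⇒dichotomy eq a c a≢c = diagonalCycles≡bound⇒ a c a≢c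
    (sum-≡⇒≗ (diagonalCycles≤bound a) (sum-≡⇒≗ (λ a → sum-mono-≤ (diagonalCycles≤bound a))
      (trans (sym (labelled4Cycles≡∑diagonalCycles G)) (trans eq (sym sum-diagonalBound))) a) c)

  dichotomy⇒labelled4Cycles-≡ : CodegreeDichotomy d G → labelled4Cycles G ≡ n * (d * (d ∸ 1) * (d ∸ 1))
  dichotomy⇒labelled4Cycles-≡ dichotomy = begin
    labelled4Cycles G          ≡⟨ labelled4Cycles≡∑diagonalCycles G ⟩
    sum (λ a → sum (diagonalCycles G a))   ≡⟨ sum-cong-≗ (sum-cong-≗ ∘ dichotomy⇒diagonalCycles≡bound dichotomy) ⟩
    sum (λ a → sum (diagonalBound a))  ≡⟨ sum-diagonalBound ⟩
    n * (d * (d ∸ 1) * (d ∸ 1)) ∎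
    where open ≡-Reasoning

≅⇒labelled4Cycles≡ : ∀ {n} {G H : Graph n} → G ≅ H → labelled4Cycles G ≡ labelled4Cycles H
≅⇒labelled4Cycles≡ {n} {G} {H} (π , π-adj) = begin
  labelled4Cycles G
    ≡⟨ labelled4Cycles≡∑diagonalCycles G ⟩
  sum (λ a → sum (λ c → diagonalCycles G a c))
    ≡⟨ sum-cong-≗ (λ a → sum-cong-≗ (diagonalCycles-≅ a)) ⟩
  sum (λ a → sum (λ c → diagonalCycles H (to a) (to c)))
    ≡⟨ sum-cong-≗ (λ a → sum-permute (diagonalCycles H (to a)) π) ⟨
  sum (λ a → sum (λ c → diagonalCycles H (to a) c))
    ≡⟨ sum-permute (λ a → sum (diagonalCycles H a)) π ⟨
  sum (λ a → sum (λ c → diagonalCycles H a c))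
    ≡⟨ labelled4Cycles≡∑diagonalCycles H ⟨
  labelled4Cycles H ∎
  where
  open ≡-Reasoning
  to : Fin n → Fin n
  to = Inverse.to π

  to-injective : ∀ {a c} → to a ≡ to c → a ≡ c
  to-injective {a} {c} eq = trans (sym (Inverse.strictlyInverseʳ π a))
                                  (trans (cong (Inverse.from π) eq) (Inverse.strictlyInverseʳ π c))

  ≠ᵇ-≅ : ∀ a c → (a ≠ᵇ c) ≡ (to a ≠ᵇ to c)
  ≠ᵇ-≅ a c = cong not (⇔→≡ (mk⇔
    (λ a≡c → ⌊⌋≡true (to a FinP.≟ to c) (cong to (⌊⌋≡true⇒ (a FinP.≟ c) a≡c)))
    (λ ta≡tc → ⌊⌋≡true (a FinP.≟ c) (to-injective (⌊⌋≡true⇒ (to a FinP.≟ to c) ta≡tc)))))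

  codegree-≅ : ∀ a c → codegree G a c ≡ codegree H (to a) (to c)
  codegree-≅ a c = trans (count-cong (λ e → cong₂ _∧_ (π-adj a e) (π-adj c e)))
                         (count-permute π (λ e → adj H (to a) e ∧ adj H (to c) e))

  diagonalCycles-≅ : ∀ a c → diagonalCycles G a c ≡ diagonalCycles H (to a) (to c)
  diagonalCycles-≅ a c = cong₂ (λ b x → [ b ] * (x * (x ∸ 1))) (≠ᵇ-≅ a c) (codegree-≅ a c)

-- The graph (n/2d) K_{d,d}

module _ {n} (β : Fin n → ℕ) (σ : Fin n → Bool) where

  private
    A : Fin n → Fin n → Bool
    A i j = ⌊ β i ≟ β j ⌋ ∧ (σ i xor σ j)

  common⇒sameBlockAndSide : ∀ a c e → A a e ∧ A c e ≡ true → β a ≡ β c × σ a ≡ σ c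
  common⇒sameBlockAndSide a c e ae∧ce with β a ≟ β e | β c ≟ β e
  common⇒sameBlockAndSide a c e ae∧ce | yes βa≡βe | yes βc≡βe =
    trans βa≡βe (sym βc≡βe) , xor-true⇒≡ (σ a) (σ c) (σ e) ae∧ce
  common⇒sameBlockAndSide a c e () | no _ | _
  common⇒sameBlockAndSide a c e ae∧ce | yes _ | no _ with () ← proj₂ (∧-true (true ∧ (σ a xor σ e)) ae∧ce)

  blockNeighbourhoods : ∀ a c → (∀ e → A a e ∧ A c e ≡ A a e) ⊎ (∀ e → A a e ∧ A c e ≡ false)
  blockNeighbourhoods a c with β a ≟ β c | σ a Data.Bool.≟ σ c
  ... | yes βa≡βc | yes σa≡σc = inj₁ λ e →
    trans (cong (A a e ∧_) (cong₂ (λ b s → ⌊ b ≟ β e ⌋ ∧ (s xor σ e)) (sym βa≡βc) (sym σa≡σc)))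
          (∧-idem (A a e))
  ... | no βa≢βc | _ = inj₂ λ e → ¬-not (βa≢βc ∘ proj₁ ∘ common⇒sameBlockAndSide a c e)
  ... | yes _ | no σa≢σc = inj₂ λ e → ¬-not (σa≢σc ∘ proj₂ ∘ common⇒sameBlockAndSide a c e)

module _ (k : ℕ) where

  private
    d m : ℕ
    d = suc k
    m = 2 * d

  -- adj (KddUnion n d) i j unfolds to oppositeInBlock (toℕ i / m) (toℕ i % m <ᵇ d) (toℕ j).
  oppositeInBlock : ℕ → Bool → ℕ → Bool
  oppositeInBlock b s r = ⌊ b ≟ r / m ⌋ ∧ (s xor (r % m <ᵇ d))

  private
    m+r/m : ∀ r → (m + r) / m ≡ suc (r / m)
    m+r/m r = trans (m/n≡1+[m∸n]/n (m≤m+n m r)) (cong (λ x → suc (x / m)) (m+n∸m≡n m r))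

    m+r%m : ∀ r → (m + r) % m ≡ r % m
    m+r%m r = trans (cong (_% m) (+-comm m r)) ([m+n]%n≡m%n r m)

    oppositeInBlock-shift : ∀ b s r → oppositeInBlock b s (m + r) ≡ ⌊ b ≟ suc (r / m) ⌋ ∧ (s xor (r % m <ᵇ d))
    oppositeInBlock-shift b s r = cong₂ (λ x y → ⌊ b ≟ x ⌋ ∧ (s xor (y <ᵇ d))) (m+r/m r) (m+r%m r)

    oppositeInBlock-first : ∀ b s r → r < m → oppositeInBlock b s r ≡ ⌊ b ≟ 0 ⌋ ∧ (s xor (r <ᵇ d))
    oppositeInBlock-first b s r r<m =
      cong₂ (λ x y → ⌊ b ≟ x ⌋ ∧ (s xor (y <ᵇ d))) (m<n⇒m/n≡0 r<m) (m<n⇒m%n≡m r<m)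

    countBelow-first : ∀ s → countBelow m (oppositeInBlock 0 s) ≡ d
    countBelow-first s = begin
      countBelow m (oppositeInBlock 0 s)
        ≡⟨ countBelow-cong m (oppositeInBlock-first 0 s) ⟩
      countBelow m (λ r → s xor (r <ᵇ d))
        ≡⟨ cong (λ N → countBelow (d + N) (λ r → s xor (r <ᵇ d))) (+-identityʳ d) ⟩
      countBelow (d + d) (λ r → s xor (r <ᵇ d))
        ≡⟨ countBelow-halves d s ⟩
      d ∎
      where open ≡-Reasoning

    countBelow-later : ∀ b s → countBelow m (oppositeInBlock (suc b) s) ≡ 0
    countBelow-later b s = begin
      countBelow m (oppositeInBlock (suc b) s)  ≡⟨ countBelow-cong m (oppositeInBlock-first (suc b) s) ⟩
      countBelow m (λ _ → false)                ≡⟨ countBelow-const m false ⟩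
      m * 0                                     ≡⟨ *-zeroʳ m ⟩
      0                                         ∎
      where open ≡-Reasoning

  countBelow-oppositeInBlock : ∀ q b s → b < q → countBelow (q * m) (oppositeInBlock b s) ≡ d
  countBelow-oppositeInBlock (suc q) b s b<q = begin
    countBelow (m + q * m) (oppositeInBlock b s)
      ≡⟨ countBelow-+ m (q * m) (oppositeInBlock b s) ⟩
    countBelow m (oppositeInBlock b s) + countBelow (q * m) (λ r → oppositeInBlock b s (m + r))
      ≡⟨ cong (countBelow m (oppositeInBlock b s) +_) (countBelow-cong (q * m) (λ r _ → oppositeInBlock-shift b s r)) ⟩
    countBelow m (oppositeInBlock b s) + countBelow (q * m) (λ r → ⌊ b ≟ suc (r / m) ⌋ ∧ (s xor (r % m <ᵇ d)))
      ≡⟨ blocks b b<q ⟩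
    d ∎
    where
    open ≡-Reasoning
    blocks : ∀ b → b < suc q →
      countBelow m (oppositeInBlock b s) + countBelow (q * m) (λ r → ⌊ b ≟ suc (r / m) ⌋ ∧ (s xor (r % m <ᵇ d))) ≡ d
    blocks zero _ = begin
      countBelow m (oppositeInBlock 0 s) + countBelow (q * m) (λ _ → false)
        ≡⟨ cong₂ _+_ (countBelow-first s) (countBelow-const (q * m) false) ⟩
      d + q * m * 0  ≡⟨ cong (d +_) (*-zeroʳ (q * m)) ⟩
      d + 0          ≡⟨ +-identityʳ d ⟩
      d              ∎
    blocks (suc b) (s≤s b<q) = cong₂ _+_ (countBelow-later b s) (begin
      countBelow (q * m) (λ r → ⌊ suc b ≟ suc (r / m) ⌋ ∧ (s xor (r % m <ᵇ d)))
        ≡⟨ countBelow-cong (q * m) (λ r _ → cong (_∧ (s xor (r % m <ᵇ d))) (⌊suc≟suc⌋ b (r / m))) ⟩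
      countBelow (q * m) (oppositeInBlock b s)
        ≡⟨ countBelow-oppositeInBlock q b s b<q ⟩
      d ∎)

  KddUnion-regular : ∀ {n} q → n ≡ q * m → Regular d (KddUnion n d)
  KddUnion-regular {n} q n≡qm i = begin
    count (adj (KddUnion n d) i)      ≡⟨ count∘toℕ {n} (oppositeInBlock b s) ⟩
    countBelow n (oppositeInBlock b s)  ≡⟨ cong (λ N → countBelow N (oppositeInBlock b s)) n≡qm ⟩
    countBelow (q * m) (oppositeInBlock b s)  ≡⟨ countBelow-oppositeInBlock q b s b<q ⟩
    d ∎
    where
    open ≡-Reasoning
    b : ℕ
    b = toℕ i / m
    s : Bool
    s = toℕ i % m <ᵇ d
    b<q : b < q
    b<q = m<n*o⇒m/o<n (subst (toℕ i <_) n≡qm (FinP.toℕ<n i))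

  KddUnion-dichotomy : ∀ {n} q → n ≡ q * m → CodegreeDichotomy d (KddUnion n d)
  KddUnion-dichotomy q n≡qm a c _ with blockNeighbourhoods (λ i → toℕ i / m) (λ i → toℕ i % m <ᵇ d) a c
  ... | inj₁ same = inj₂ (trans (count-cong same) (KddUnion-regular q n≡qm a))
  ... | inj₂ none = inj₁ (count-false _ none)

-- Regular graphs whose codegrees are all 0 or d

Twins : ∀ {n} → Graph n → Fin n → Fin n → Set
Twins G u v = ∀ w → adj G u w ≡ adj G v w

twins? : ∀ {n} (G : Graph n) (u v : Fin n) → Dec (Twins G u v)
twins? G u v = FinP.all? (λ w → adj G u w Data.Bool.≟ adj G v w)

adj⇒¬Twins : ∀ {n} (G : Graph n) {u v} → adj G u v ≡ true → ¬ Twins G u v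
adj⇒¬Twins G {u} {v} uv twins with () ← trans (sym (adj-irr G v)) (trans (sym (twins v)) uv)

module _ (k : ℕ) {n} (G : Graph n) (regular : Regular (suc k) G)
         (dichotomy : CodegreeDichotomy (suc k) G) where

  private
    d m : ℕ
    d = suc k
    m = 2 * d

  path⇒Twins : ∀ {u w v} → adj G u w ≡ true → adj G w v ≡ true → Twins G u v
  path⇒Twins {u} {w} {v} uw wv = twins (u FinP.≟ v)
    where
    full⇒Twins : codegree G u v ≡ d → Twins G u v
    full⇒Twins cd≡d e = ⇔→≡ (mk⇔ (codegree≡d⇒⊆ G regular cd≡d e) (codegree≡d⇒⊆ G regular cd′≡d e))
      where
      cd′≡d : codegree G v u ≡ d
      cd′≡d = trans (count-cong (λ e → ∧-comm (adj G v e) (adj G u e))) cd≡d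
    empty⇒Twins : codegree G u v ≡ 0 → Twins G u v
    empty⇒Twins cd≡0 = contradiction (subst (0 <_) cd≡0 (count-pos _ w (cong₂ _∧_ uw (adj-flip G wv)))) λ ()
    twins : Dec (u ≡ v) → Twins G u v
    twins (yes refl) _ = refl
    twins (no u≢v) = [ empty⇒Twins , full⇒Twins ]′ (dichotomy u v u≢v)

  SameBlock : Fin n → Fin n → Set
  SameBlock u v = Twins G u v ⊎ adj G u v ≡ true

  sameBlock? : ∀ u v → Dec (SameBlock u v)
  sameBlock? u v = twins? G u v ⊎-dec (adj G u v Data.Bool.≟ true)

  SameBlock-sym : ∀ {u v} → SameBlock u v → SameBlock v u
  SameBlock-sym (inj₁ twins) = inj₁ (sym ∘ twins)
  SameBlock-sym (inj₂ uv) = inj₂ (adj-flip G uv)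

  SameBlock-trans : ∀ {u x v} → SameBlock u x → SameBlock x v → SameBlock u v
  SameBlock-trans (inj₁ ux) (inj₁ xv) = inj₁ (λ w → trans (ux w) (xv w))
  SameBlock-trans {v = v} (inj₁ ux) (inj₂ xv) = inj₂ (trans (ux v) xv)
  SameBlock-trans {u} (inj₂ ux) (inj₁ xv) = inj₂ (adj-flip G (trans (sym (xv u)) (adj-flip G ux)))
  SameBlock-trans (inj₂ ux) (inj₂ xv) = inj₁ (path⇒Twins ux xv)

  block : Fin n → Fin n → Bool
  block v u = ⌊ sameBlock? u v ⌋

  block-cong : ∀ {u v} → SameBlock u v → ∀ w → block u w ≡ block v w
  block-cong uv w = ⇔→≡ (mk⇔
    (λ wu → ⌊⌋≡true (sameBlock? w _) (SameBlock-trans (⌊⌋≡true⇒ (sameBlock? w _) wu) uv))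
    (λ wv → ⌊⌋≡true (sameBlock? w _) (SameBlock-trans (⌊⌋≡true⇒ (sameBlock? w _) wv) (SameBlock-sym uv))))

  leader-spec : ∀ v → ∃ λ r → block v r ≡ true × rank (block v) r ≡ 0
  leader-spec v = rank-surjective (block v) (count-pos (block v) v (⌊⌋≡true (sameBlock? v v) (inj₁ λ _ → refl)))

  leader : Fin n → Fin n
  leader v = proj₁ (leader-spec v)

  leader-sameBlock : ∀ v → SameBlock v (leader v)
  leader-sameBlock v = SameBlock-sym (⌊⌋≡true⇒ (sameBlock? (leader v) v) (proj₁ (proj₂ (leader-spec v))))

  leader-cong : ∀ {u v} → SameBlock u v → leader u ≡ leader v
  leader-cong {u} {v} uv = rank-injective (block v)
    (trans (sym (block-cong uv (leader u))) (proj₁ (proj₂ (leader-spec u))))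
    (proj₁ (proj₂ (leader-spec v)))
    (begin
      rank (block v) (leader u)  ≡⟨ rank-cong (block-cong uv) (leader u) ⟨
      rank (block u) (leader u)  ≡⟨ proj₂ (proj₂ (leader-spec u)) ⟩
      0                          ≡⟨ proj₂ (proj₂ (leader-spec v)) ⟨
      rank (block v) (leader v)  ∎)
    where open ≡-Reasoning

  isLeader : Fin n → Bool
  isLeader r = ⌊ leader r FinP.≟ r ⌋

  isLeader-leader : ∀ v → isLeader (leader v) ≡ true
  isLeader-leader v = ⌊⌋≡true (leader (leader v) FinP.≟ leader v) (leader-cong (SameBlock-sym (leader-sameBlock v)))

  blockCount : ℕ
  blockCount = count isLeader

  blockIndex : Fin n → ℕ
  blockIndex v = rank isLeader (leader v)

  blockIndex-injective : ∀ {u v} → blockIndex u ≡ blockIndex v → leader u ≡ leader v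
  blockIndex-injective = rank-injective isLeader (isLeader-leader _) (isLeader-leader _)

  twin : Fin n → Fin n → Bool
  twin v u = ⌊ twins? G u v ⌋

  twin-cong : ∀ {u v} → Twins G u v → ∀ w → twin u w ≡ twin v w
  twin-cong uv w = ⇔→≡ (mk⇔
    (λ wu → ⌊⌋≡true (twins? G w _) (λ x → trans (⌊⌋≡true⇒ (twins? G w _) wu x) (uv x)))
    (λ wv → ⌊⌋≡true (twins? G w _) (λ x → trans (⌊⌋≡true⇒ (twins? G w _) wv x) (sym (uv x)))))

  twin≡true : ∀ {u r} → Twins G u r → twin r u ≡ true
  twin≡true {u} {r} = ⌊⌋≡true (twins? G u r)

  twin≡false : ∀ {u r} → adj G u r ≡ true → twin r u ≡ false
  twin≡false {u} {r} ur = ⌊⌋≡false (twins? G u r) (adj⇒¬Twins G ur)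

  twin-self : ∀ v → twin v v ≡ true
  twin-self v = ⌊⌋≡true (twins? G v v) (λ _ → refl)

  neighbour : ∀ v → ∃ λ w → adj G v w ≡ true
  neighbour v = let (w , vw , _) = rank-surjective (adj G v) {0} (subst (0 <_) (sym (regular v)) (s≤s z≤n)) in w , vw

  count-twin : ∀ v → count (twin v) ≡ d
  count-twin v = let (w , vw) = neighbour v in trans (count-cong (λ u → ⇔→≡ (mk⇔
    (λ uv → adj-flip G (trans (⌊⌋≡true⇒ (twins? G u v) uv w) vw))
    (λ wu → ⌊⌋≡true (twins? G u v) (path⇒Twins (adj-flip G wu) (adj-flip G vw))))))
    (regular w)

  pos : Fin n → ℕ
  pos v = rank (twin v) v

  pos<d : ∀ v → pos v < d
  pos<d v = subst (pos v <_) (count-twin v) (rank<count (twin v) (twin-self v))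

  pos-injective : ∀ {u v} → Twins G u v → pos u ≡ pos v → u ≡ v
  pos-injective {u} {v} uv pu≡pv = rank-injective (twin v)
    (trans (sym (twin-cong uv u)) (twin-self u)) (twin-self v)
    (trans (sym (rank-cong (twin-cong uv) u)) pu≡pv)

  twin-at : ∀ x {t} → t < d → ∃ λ v → Twins G v x × pos v ≡ t
  twin-at x t<d =
    let (v , xv , rv) = rank-surjective (twin x) (subst (_ <_) (sym (count-twin x)) t<d)
        vx : Twins G v x
        vx = ⌊⌋≡true⇒ (twins? G v x) xv
    in v , vx , trans (rank-cong (twin-cong vx) v) rv

  onLeaderSide : Fin n → Bool
  onLeaderSide v = twin (leader v) v

  offSide⇒adj : ∀ {v} → onLeaderSide v ≡ false → adj G v (leader v) ≡ true
  offSide⇒adj {v} off =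
    [ (λ twins → contradiction (trans (sym off) (twin≡true twins)) λ ()) , id ]′ (leader-sameBlock v)

  adj-within-block : ∀ {u v r} → SameBlock u r → SameBlock v r → adj G u v ≡ twin r u xor twin r v
  adj-within-block {u} {v} (inj₁ ur) (inj₁ vr) = trans
    (¬-not (λ uv → adj⇒¬Twins G uv (λ w → trans (ur w) (sym (vr w)))))
    (sym (cong₂ _xor_ (twin≡true ur) (twin≡true vr)))
  adj-within-block {u} {v} (inj₁ ur) (inj₂ vr) = trans
    (trans (ur v) (adj-flip G vr))
    (sym (cong₂ _xor_ (twin≡true ur) (twin≡false vr)))
  adj-within-block {u} {v} (inj₂ ur) (inj₁ vr) = trans
    (adj-flip G (trans (vr u) (adj-flip G ur)))
    (sym (cong₂ _xor_ (twin≡false ur) (twin≡true vr)))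
  adj-within-block (inj₂ ur) (inj₂ vr) = trans
    (¬-not (λ uv → adj⇒¬Twins G uv (path⇒Twins ur (adj-flip G vr))))
    (sym (cong₂ _xor_ (twin≡false ur) (twin≡false vr)))

  adj≡blockIndex∧side : ∀ u v →
    adj G u v ≡ ⌊ blockIndex u ≟ blockIndex v ⌋ ∧ (onLeaderSide u xor onLeaderSide v)
  adj≡blockIndex∧side u v = go (blockIndex u ≟ blockIndex v)
    where
    go : (b? : Dec (blockIndex u ≡ blockIndex v)) →
         adj G u v ≡ ⌊ b? ⌋ ∧ (onLeaderSide u xor onLeaderSide v)
    go (yes bu≡bv) = trans
      (adj-within-block (leader-sameBlock u) (subst (SameBlock v) (sym lu≡lv) (leader-sameBlock v)))
      (cong (λ r → onLeaderSide u xor twin r v) lu≡lv)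
      where
      lu≡lv : leader u ≡ leader v
      lu≡lv = blockIndex-injective bu≡bv
    go (no bu≢bv) = ¬-not (λ uv → bu≢bv (cong (rank isLeader) (leader-cong (inj₂ uv))))

  offset : Bool → ℕ
  offset true = 0
  offset false = d

  offset+<m : ∀ s {t} → t < d → offset s + t < m
  offset+<m true t<d = ≤-trans t<d (m≤m+n d (d + 0))
  offset+<m false t<d = +-monoʳ-< d (≤-trans t<d (m≤m+n d 0))

  offset+<ᵇd : ∀ s {t} → t < d → (offset s + t <ᵇ d) ≡ s
  offset+<ᵇd true t<d = <⇒<ᵇ≡true t<d
  offset+<ᵇd false {t} _ = ≥⇒<ᵇ≡false (m≤m+n d t)

  offset-split : ∀ {o} → o < m → ∃₂ λ s t → t < d × offset s + t ≡ o
  offset-split {o} o<m = split (o <? d)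
    where
    split : Dec (o < d) → ∃₂ λ s t → t < d × offset s + t ≡ o
    split (yes o<d) = true , o , o<d , refl
    split (no o≮d) = false , o ∸ d , o∸d<d , m+[n∸m]≡n (≮⇒≥ o≮d)
      where
      o∸d<d : o ∸ d < d
      o∸d<d = +-cancelˡ-< d (o ∸ d) d (begin-strict
        d + (o ∸ d)  ≡⟨ m+[n∸m]≡n (≮⇒≥ o≮d) ⟩
        o            <⟨ o<m ⟩
        d + (d + 0)  ≡⟨ cong (d +_) (+-identityʳ d) ⟩
        d + d        ∎)
        where open ≤-Reasoning

  label : Fin n → ℕ
  label v = offset (onLeaderSide v) + pos v + blockIndex v * m

  label/m : ∀ v → label v / m ≡ blockIndex v
  label/m v = [r+kn]/n≡k (blockIndex v) m (offset+<m (onLeaderSide v) (pos<d v))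

  label%m<ᵇd : ∀ v → (label v % m <ᵇ d) ≡ onLeaderSide v
  label%m<ᵇd v = trans (cong (_<ᵇ d) ([r+kn]%n≡r (blockIndex v) m (offset+<m (onLeaderSide v) (pos<d v))))
                       (offset+<ᵇd (onLeaderSide v) (pos<d v))

  adj≡label : ∀ u v → adj G u v ≡ ⌊ label u / m ≟ label v / m ⌋ ∧ ((label u % m <ᵇ d) xor (label v % m <ᵇ d))
  adj≡label u v = trans (adj≡blockIndex∧side u v) (sym (cong₂ _∧_
    (cong₂ (λ x y → ⌊ x ≟ y ⌋) (label/m u) (label/m v))
    (cong₂ _xor_ (label%m<ᵇd u) (label%m<ᵇd v))))

  sameSide⇒Twins : ∀ {u v} → leader u ≡ leader v → onLeaderSide u ≡ onLeaderSide v → Twins G u v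
  sameSide⇒Twins {u} {v} lu≡lv su≡sv = go (onLeaderSide u) refl (sym su≡sv)
    where
    go : ∀ s → onLeaderSide u ≡ s → onLeaderSide v ≡ s → Twins G u v
    go true su sv w = trans (⌊⌋≡true⇒ (twins? G u (leader u)) su w)
      (trans (cong (λ r → adj G r w) lu≡lv) (sym (⌊⌋≡true⇒ (twins? G v (leader v)) sv w)))
    go false su sv =
      path⇒Twins (subst (λ r → adj G u r ≡ true) lu≡lv (offSide⇒adj su)) (adj-flip G (offSide⇒adj sv))

  label-injective : ∀ {u v} → label u ≡ label v → u ≡ v
  label-injective {u} {v} lu≡lv = pos-injective (sameSide⇒Twins leaders sides) positions
    where
    leaders : leader u ≡ leader v
    leaders = blockIndex-injective (trans (sym (label/m u)) (trans (cong (_/ m) lu≡lv) (label/m v)))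
    sides : onLeaderSide u ≡ onLeaderSide v
    sides = trans (sym (label%m<ᵇd u)) (trans (cong (λ x → x % m <ᵇ d) lu≡lv) (label%m<ᵇd v))
    positions : pos u ≡ pos v
    positions = +-cancelˡ-≡ (offset (onLeaderSide u)) (pos u) (pos v)
      (+-cancelʳ-≡ (blockIndex v * m) _ _ (begin
        offset (onLeaderSide u) + pos u + blockIndex v * m
          ≡⟨ cong (λ b → offset (onLeaderSide u) + pos u + rank isLeader b * m) leaders ⟨
        label u
          ≡⟨ lu≡lv ⟩
        label v
          ≡⟨ cong (λ s → offset s + pos v + blockIndex v * m) sides ⟨
        offset (onLeaderSide u) + pos v + blockIndex v * m ∎))
      where open ≡-Reasoning

  label<blockCount*m : ∀ v → label v < blockCount * m
  label<blockCount*m v = begin-strict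
    offset (onLeaderSide v) + pos v + blockIndex v * m
      <⟨ +-monoˡ-< (blockIndex v * m) (offset+<m (onLeaderSide v) (pos<d v)) ⟩
    m + blockIndex v * m
      ≤⟨ *-monoˡ-≤ m (rank<count isLeader (isLeader-leader v)) ⟩
    blockCount * m ∎
    where open ≤-Reasoning

  vertex-at : ∀ {r} → isLeader r ≡ true → ∀ s {t} → t < d →
    ∃ λ v → leader v ≡ r × onLeaderSide v ≡ s × pos v ≡ t
  vertex-at {r} r-leads true t<d =
    let (v , vr , pv) = twin-at r t<d
        lv≡r : leader v ≡ r
        lv≡r = trans (leader-cong (inj₁ vr)) (⌊⌋≡true⇒ (leader r FinP.≟ r) r-leads)
    in v , lv≡r , subst (λ x → twin x v ≡ true) (sym lv≡r) (twin≡true vr) , pv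
  vertex-at {r} r-leads false t<d =
    let (w , rw) = neighbour r
        (v , vw , pv) = twin-at w t<d
        vr : adj G v r ≡ true
        vr = trans (vw r) (adj-flip G rw)
        lv≡r : leader v ≡ r
        lv≡r = trans (leader-cong (inj₂ vr)) (⌊⌋≡true⇒ (leader r FinP.≟ r) r-leads)
    in v , lv≡r , subst (λ x → twin x v ≡ false) (sym lv≡r) (twin≡false vr) , pv

  label-onto : ∀ y → y < blockCount * m → ∃ λ v → label v ≡ y
  label-onto y y<cm =
    let (r , r-leads , rank-r) = rank-surjective isLeader (m<n*o⇒m/o<n {y} {blockCount} {m} y<cm)
        (s , t , t<d , o≡y%m) = offset-split (m%n<n y m)
        (v , lv≡r , sv≡s , pv≡t) = vertex-at r-leads s t<d
    in v , (begin
      offset (onLeaderSide v) + pos v + rank isLeader (leader v) * m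
        ≡⟨ cong₂ (λ x b → offset x + pos v + rank isLeader b * m) sv≡s lv≡r ⟩
      offset s + pos v + rank isLeader r * m
        ≡⟨ cong₂ (λ p b → offset s + p + b * m) pv≡t rank-r ⟩
      offset s + t + y / m * m
        ≡⟨ cong (_+ y / m * m) o≡y%m ⟩
      y % m + y / m * m
        ≡⟨ m≡m%n+[m/n]*n y m ⟨
      y ∎)
    where open ≡-Reasoning

  dichotomy⇒≅KddUnion : G ≅ KddUnion n d
  dichotomy⇒≅KddUnion = π , λ u v → trans (adj≡label u v)
    -- the right-hand side is adj (KddUnion n d) (Inverse.to π u) (Inverse.to π v), unfolded
    (cong₂ (λ x y → ⌊ x / m ≟ y / m ⌋ ∧ ((x % m <ᵇ d) xor (y % m <ᵇ d)))
           (sym (π≗label u)) (sym (π≗label v)))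
    where
    enumeration : Σ (Fin n ↔ Fin n) λ π → ∀ v → toℕ (Inverse.to π v) ≡ label v
    enumeration = injection-onto⇒↔ label label-injective label<blockCount*m label-onto
    π : Fin n ↔ Fin n
    π = proj₁ enumeration
    π≗label : ∀ v → toℕ (Inverse.to π v) ≡ label v
    π≗label = proj₂ enumeration

-- From labelled 4-cycles to c₄

c4-mono : ∀ {n} {G H : Graph n} → labelled4Cycles G ≤ labelled4Cycles H → c4 G ≤ c4 H
c4-mono = /-monoˡ-≤ 8

c4≡⇒labelled4Cycles≡ : ∀ {n} {G H : Graph n} → 8 ∣ labelled4Cycles H →
  labelled4Cycles G ≤ labelled4Cycles H → c4 G ≡ c4 H → labelled4Cycles G ≡ labelled4Cycles H
c4≡⇒labelled4Cycles≡ {n} {G} {H} 8∣LH LG≤LH c4G≡c4H = ≤-antisym LG≤LH (begin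
  labelled4Cycles H            ≡⟨ m/n*n≡m 8∣LH ⟨
  c4 H * 8                     ≡⟨ cong (_* 8) c4G≡c4H ⟨
  c4 G * 8                     ≤⟨ m/n*n≤m (labelled4Cycles G) 8 ⟩
  labelled4Cycles G            ∎)
  where open ≤-Reasoning

lemma2p1 : (n d : ℕ) → 1 ≤ d → (2 * d) ∣ n → (G : Graph n) →
    Regular d G → TriangleFree G →
    (c4 G ≤ c4 (KddUnion n d)) × ((c4 G ≡ c4 (KddUnion n d)) ⇔ (G ≅ KddUnion n d))
lemma2p1 n d@(suc k) _ 2d∣n@(divides q n≡q*2d) G regular _ =
  c4-mono {G = G} {H = K} LG≤LK ,
  mk⇔ (dichotomy⇒≅KddUnion k G regular ∘ labelled4Cycles-≡⇒dichotomy G regular ∘ LG≡bound)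
      (cong (_/ 8) ∘ ≅⇒labelled4Cycles≡ {G = G} {H = K})
  where
  K : Graph n
  K = KddUnion n d
  bound : ℕ
  bound = n * (d * (d ∸ 1) * (d ∸ 1))
  LK≡bound : labelled4Cycles K ≡ bound
  LK≡bound = dichotomy⇒labelled4Cycles-≡ K (KddUnion-regular k q n≡q*2d) (KddUnion-dichotomy k q n≡q*2d)
  LG≤LK : labelled4Cycles G ≤ labelled4Cycles K
  LG≤LK = ≤-trans (labelled4Cycles-≤ G regular) (≤-reflexive (sym LK≡bound))
  LG≡bound : c4 G ≡ c4 K → labelled4Cycles G ≡ bound
  LG≡bound c4G≡c4K = trans (c4≡⇒labelled4Cycles≡ {G = G} {H = K} 8∣LK LG≤LK c4G≡c4K) LK≡bound
    where
    8∣LK : 8 ∣ labelled4Cycles K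
    8∣LK = subst (8 ∣_) (sym LK≡bound) (8∣n*d*[d∸1]² d 2d∣n)
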